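{- Let $G=(V,E^+\cup E^-)$ be a complete graph and let $\{d_{uv}\}$ be the output of a $\beta$-level predictor. Form a random complete graph $G'=(V,E'^+\cup E'^-)$ by placing each pair $(u,v)$ independently in $E'^+$ with probability $1-p_{uv}$ and in $E'^-$ otherwise. Then $\mathbb E[\mathrm{OPT}']\le(2\beta+1)\cdot\mathrm{OPT}$, where $\mathrm{OPT}$ and $\mathrm{OPT}'$ are the optimal Correlation Clustering costs on $G$ and $G'$, respectively.
   Context: For a partition $\mathcal C$ of $V$, the Correlation Clustering cost on a graph with positive/negative edges is the number of positive edges between different clusters plus the number of negative edges inside clusters; $\mathrm{OPT}$ denotes the minimum over partitions. A $\beta$-level predictor gives $d_{uv}\in[0,1]$ for all pairs with $d_{uv}+d_{vw}\ge d_{uw}$ and $\sum_{(u,v)\in E^+}d_{uv}+\sum_{(u,v)\in E^- }(1-d_{uv})\le\beta\,\mathrm{OPT}$. With $a=0.19$, $b=0.5095$: $f^+(x)=0$ for $x<a$, $((x-a)/(b-a))^2$ for $x\in[a,b]$, $1$ for $x>b$; $f^-(x)=x$; $p_{uv}=f^+(d_{uv})$ if $(u,v)\in E^+$ and $p_{uv}=f^-(d_{uv})$ if $(u,v)\in E^-$.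
   Formalization: The predictor outputs $d_{uv}$ and the parameter $\beta$ are taken in the rationals. -}

module Defs where

open import Data.Bool using (Bool; true; false; if_then_else_)
open import Data.Nat as ℕ using (ℕ; zero; suc)
open import Data.Fin as Fin using (Fin; toℕ)
open import Data.Fin.Properties using () renaming (_≟_ to _≟ᶠ_)
open import Data.Integer using (+_)
open import Data.List using (List; []; _∷_; map; concatMap; allFin; foldr; sum; filter; length; _++_)
open import Data.Vec using (Vec; []; _∷_; lookup)
open import Data.Product using (_×_; _,_)
open import Data.Rational using (ℚ; 0ℚ; 1ℚ; _+_; _*_; _-_; _÷_; _/_; _≤_; _<_)
open import Data.Rational.Properties using (_≤?_; _<?_)
open import Relation.Nullary using (yes; no; ¬_)
open import Relation.Nullary.Decidable using (⌊_⌋)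
open import Relation.Binary.PropositionalEquality using (_≡_)
open import Data.Bool.Properties using () renaming (_≟_ to _≟b_)

-- A complete signed graph on vertex set V = Fin n: for u < v,
-- s u v = true means (u,v) ∈ E⁺ and s u v = false means (u,v) ∈ E⁻.
-- Only the entries with toℕ u < toℕ v are ever read.
Signs : ℕ → Set
Signs n = Fin n → Fin n → Bool

pairs : (n : ℕ) → List (Fin n × Fin n)
pairs n = concatMap (λ u → map (λ v → (u , v)) (filter (λ v → toℕ u ℕ.<? toℕ v) (allFin n))) (allFin n)

-- A partition of V = Fin n is given by a cluster labelling c : Fin n → Fin n
-- (every partition of an n-element set arises this way; u,v are in the same
-- cluster iff c u = c v).
disagrees : {n : ℕ} → Signs n → (Fin n → Fin n) → Fin n × Fin n → Bool
disagrees s c (u , v) with s u v | c u ≟ᶠ c v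
... | true  | yes _ = false
... | true  | no  _ = true
... | false | yes _ = true
... | false | no  _ = false

cost : {n : ℕ} → Signs n → (Fin n → Fin n) → ℕ
cost {n} s c = length (filter (λ e → disagrees s c e ≟b true) (pairs n))

allVecs : (k m : ℕ) → List (Vec (Fin m) k)
allVecs zero    m = [] ∷ []
allVecs (suc k) m = concatMap (λ x → map (x ∷_) (allVecs k m)) (allFin m)

OPT : {n : ℕ} → Signs n → ℕ
OPT {zero}  s = 0
OPT {suc n} s = foldr (λ v r → ℕ._⊓_ (cost s (lookup v)) r) (cost s (λ _ → Fin.zero))
                      (allVecs (suc n) (suc n))

Σpairs : (n : ℕ) → (Fin n → Fin n → ℚ) → ℚ
Σpairs n g = foldr (λ { (u , v) r → g u v + r }) 0ℚ (pairs n)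

predictorCost : {n : ℕ} → Signs n → (Fin n → Fin n → ℚ) → ℚ
predictorCost {n} s d = Σpairs n (λ u v → if s u v then d u v else 1ℚ - d u v)

fromℕ : ℕ → ℚ
fromℕ k = + k / 1

record IsPredictor {n : ℕ} (s : Signs n) (β : ℚ) (d : Fin n → Fin n → ℚ) : Set where
  field
    nonneg   : ∀ u v → 0ℚ ≤ d u v
    le-one   : ∀ u v → d u v ≤ 1ℚ
    symm     : ∀ u v → d u v ≡ d v u
    triangle : ∀ u v w → ¬ u ≡ v → ¬ v ≡ w → ¬ u ≡ w → d u w ≤ d u v + d v w
    bounded  : predictorCost s d ≤ β * fromℕ (OPT s)

a b : ℚ
a = + 19 / 100
b = + 5095 / 10000

-- 1 / (b - a) = 1 / 0.3195 = 10000 / 3195, written as a literal to avoid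
-- instance resolution of NonZero (b - a) by normalisation.
inv[b-a] : ℚ
inv[b-a] = + 10000 / 3195

f⁺ : ℚ → ℚ
f⁺ x = if ⌊ x <? a ⌋ then 0ℚ
        else if ⌊ x ≤? b ⌋ then ((x - a) * inv[b-a]) * ((x - a) * inv[b-a])
        else 1ℚ

f⁻ : ℚ → ℚ
f⁻ x = x

prob : {n : ℕ} → Signs n → (Fin n → Fin n → ℚ) → Fin n → Fin n → ℚ
prob s d u v = if s u v then f⁺ (d u v) else f⁻ (d u v)

setSign : {n : ℕ} → Fin n → Fin n → Bool → Signs n → Signs n
setSign u v σ s x y with x ≟ᶠ u | y ≟ᶠ v
... | yes _ | yes _ = σ
... | _     | _     = s x y

-- Expectation of OPT' over the random graph G': each remaining pair (u,v)
-- is independently positive with probability 1 - q u v and negative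
-- with probability q u v; the expectation is the exact finite sum over all
-- outcomes weighted by their product probabilities.
expectOPT : {n : ℕ} → (Fin n → Fin n → ℚ) → List (Fin n × Fin n) → Signs n → ℚ
expectOPT q []              s = fromℕ (OPT s)
expectOPT q ((u , v) ∷ ps) s =
  (1ℚ - q u v) * expectOPT q ps (setSign u v true s)
  + q u v * expectOPT q ps (setSign u v false s)

EOPT' : {n : ℕ} → Signs n → (Fin n → Fin n → ℚ) → ℚ
EOPT' {n} s d = expectOPT (prob s d) (pairs n) s

-- Fix a clustering c that is optimal for G. For every outcome G′, OPT′ is at most the cost of c
-- on G′, which exceeds its cost OPT on G by at most the number of pairs whose sign was flipped.
-- A positive pair is flipped with probability f⁺(d) ≤ 2d and a negative one with probability
-- 1 − d ≤ 2(1 − d), so the expected number of flips is at most twice the predictor's cost,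
-- hence at most 2β · OPT. Since the expectation resamples one pair at a time, the bound
-- E[OPT′] ≤ OPT + E[number of flips] is proved by induction over the pairs, from any partially
-- resampled graph.
module Submission where

open import Defs

open import Data.Bool using (Bool; true; false; if_then_else_)
open import Data.Bool.Properties using () renaming (_≟_ to _≟ᵇ_)
open import Data.Fin as Fin using (Fin)
open import Data.Fin.Properties using () renaming (_≟_ to _≟ᶠ_)
open import Data.Integer as ℤ using (+_)
import Data.Integer.Properties as ℤ
open import Data.List using (List; []; _∷_; map; concatMap; filter; length; foldr)
open import Data.List.Properties using (filter-≐)
open import Data.List.Membership.Propositional using (_∈_; lose)
open import Data.List.Membership.Propositional.Properties using (∈-map⁺; ∈-map⁻; ∈-concatMap⁺; ∈-allFin)
open import Data.List.Relation.Binary.Disjoint.Propositional using (Disjoint)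
open import Data.List.Relation.Unary.All as All using (All; []; _∷_)
import Data.List.Relation.Unary.All.Properties as All
open import Data.List.Relation.Unary.AllPairs as AllPairs using ([]; _∷_)
import Data.List.Relation.Unary.AllPairs.Properties as AllPairs
open import Data.List.Relation.Unary.Any using (here; there)
open import Data.List.Relation.Unary.Unique.Propositional using (Unique)
import Data.List.Relation.Unary.Unique.Propositional.Properties as Unique
open import Data.Nat as ℕ using (ℕ; zero; suc; _⊓_; z≤n; s≤s)
import Data.Nat.Properties as ℕ
open import Data.Nat.Coprimality using (1-coprimeTo) renaming (sym to coprime-sym)
open import Data.Product using (_×_; _,_; ∃; proj₁; proj₂)
open import Data.Product.Properties using (≡-dec)
open import Data.Rational using (ℚ; mkℚ; 0ℚ; 1ℚ; _+_; _*_; _-_; _/_; _≤_; _<_; *≤*; nonNegative)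
open import Data.Rational.Properties
  using (module ≤-Reasoning; _≤?_; _<?_; ≮⇒≥; ≰⇒>; <⇒≤; normalize-coprime; ≤-refl; ≤-trans; ≤-reflexive;
         +-mono-≤; +-monoˡ-≤; +-monoʳ-≤; +-identityʳ; +-inverseʳ; *-monoˡ-≤-nonNeg; *-monoʳ-≤-nonNeg;
         *-distribˡ-+; *-zeroʳ; *-identityˡ; nonNegative⁻¹; nonNeg*nonNeg⇒nonNeg)
open import Data.Rational.Solver using (module +-*-Solver)
open import Data.Sum using (_⊎_; inj₁; inj₂)
open import Data.Unit using (tt)
open import Data.Vec as Vec using (tabulate; lookup)
open import Data.Vec.Properties using (lookup∘tabulate)
open import Function using (_∘_)
open import Level using (0ℓ)
open import Relation.Binary using (DecidableEquality)
open import Relation.Binary.PropositionalEquality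
open import Relation.Nullary using (Dec; yes; no; contradiction)
open import Relation.Nullary.Decidable using (decidable-stable; ⌊_⌋; toWitness)
open import Relation.Unary using (Pred; Decidable)

module _ {A : Set} {P Q : Pred A 0ℓ} (P? : Decidable P) (Q? : Decidable Q) where

  length-filter-mono : ∀ {xs} → All (λ x → P x → Q x) xs →
                       length (filter P? xs) ℕ.≤ length (filter Q? xs)
  length-filter-mono {[]}     []           = z≤n
  length-filter-mono {x ∷ xs} (P⇒Q ∷ P⇒Qs) with P? x | Q? x
  ... | yes _  | yes _  = s≤s (length-filter-mono P⇒Qs)
  ... | yes px | no ¬qx = contradiction (P⇒Q px) ¬qx
  ... | no  _  | yes _  = ℕ.m≤n⇒m≤1+n (length-filter-mono P⇒Qs)
  ... | no  _  | no  _  = length-filter-mono P⇒Qs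

  length-filter-≤-suc : (_≟_ : DecidableEquality A) → ∀ {y xs} → Unique xs → (∀ {x} → x ≢ y → P x → Q x) →
                        length (filter P? xs) ℕ.≤ suc (length (filter Q? xs))
  length-filter-≤-suc _≟_     {xs = []}     []         P⇒Q = z≤n
  length-filter-≤-suc _≟_ {y} {x ∷ xs}     (x∉ ∷ !xs) P⇒Q with P? x | Q? x
  ... | yes _  | yes _  = s≤s (length-filter-≤-suc _≟_ !xs P⇒Q)
  ... | no  _  | yes _  = ℕ.m≤n⇒m≤1+n (length-filter-≤-suc _≟_ !xs P⇒Q)
  ... | no  _  | no  _  = length-filter-≤-suc _≟_ !xs P⇒Q
  ... | yes px | no ¬qx = s≤s (length-filter-mono (All.map (λ x≢z → P⇒Q (x≢z ∘ trans x≡y ∘ sym)) x∉))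
    where
    x≡y : x ≡ y
    x≡y = decidable-stable (x ≟ y) (λ x≢y → ¬qx (P⇒Q x≢y px))

dependentProduct⁺ : {A B : Set} {xs : List A} (ys : A → List B) → Unique xs → (∀ x → Unique (ys x)) →
                    Unique (concatMap (λ x → map (x ,_) (ys x)) xs)
dependentProduct⁺ ys !xs !ys =
  Unique.concat⁺ (All.map⁺ (All.universal (λ x → Unique.map⁺ (cong proj₂) (!ys x)) _))
                 (AllPairs.map⁺ (AllPairs.map disjoint !xs))
  where
  disjoint : ∀ {x x′} → x ≢ x′ → Disjoint (map (x ,_) (ys x)) (map (x′ ,_) (ys x′))
  disjoint x≢x′ (v∈ , v∈′) with ∈-map⁻ (_ ,_) v∈ | ∈-map⁻ (_ ,_) v∈′
  ... | _ , _ , refl | _ , _ , v≡ = x≢x′ (cong proj₁ v≡)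

module _ {A : Set} (f : A → ℕ) (m₀ : ℕ) where

  minimumBy : List A → ℕ
  minimumBy = foldr (λ x r → f x ⊓ r) m₀

  minimumBy-≤ : ∀ {x xs} → x ∈ xs → minimumBy xs ℕ.≤ f x
  minimumBy-≤ (here refl)  = ℕ.m⊓n≤m _ _
  minimumBy-≤ (there x∈xs) = ℕ.≤-trans (ℕ.m⊓n≤n _ _) (minimumBy-≤ x∈xs)

  minimumBy-sel : ∀ xs → minimumBy xs ≡ m₀ ⊎ ∃ λ x → minimumBy xs ≡ f x
  minimumBy-sel []       = inj₁ refl
  minimumBy-sel (x ∷ xs) with ℕ.⊓-sel (f x) (minimumBy xs) | minimumBy-sel xs
  ... | inj₁ ≡fx | _             = inj₂ (x , ≡fx)
  ... | inj₂ ≡mx | inj₁ mx≡m₀    = inj₁ (trans ≡mx mx≡m₀)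
  ... | inj₂ ≡mx | inj₂ (y , ≡fy) = inj₂ (y , trans ≡mx ≡fy)

disagrees-congˡ : ∀ {n} {s s′ : Signs n} {u v} (c : Fin n → Fin n) →
                  s u v ≡ s′ u v → disagrees s c (u , v) ≡ disagrees s′ c (u , v)
disagrees-congˡ c s≡ rewrite s≡ = refl

disagrees-congʳ : ∀ {n} (s : Signs n) {c c′ : Fin n → Fin n} {u v} →
                  c u ≡ c′ u → c v ≡ c′ v → disagrees s c (u , v) ≡ disagrees s c′ (u , v)
disagrees-congʳ s {c} {c′} {u} {v} cu≡ cv≡ with s u v | c u ≟ᶠ c v | c′ u ≟ᶠ c′ v
... | true  | yes _  | yes _  = refl
... | false | yes _  | yes _  = refl
... | true  | no _   | no _   = refl
... | false | no _   | no _   = refl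
... | _     | yes eq | no ne  = contradiction (trans (sym cu≡) (trans eq cv≡)) ne
... | _     | no ne  | yes eq = contradiction (trans cu≡ (trans eq (sym cv≡))) ne

cost-cong : ∀ {n} {s s′ : Signs n} {c c′ : Fin n → Fin n} →
            (∀ u v → s u v ≡ s′ u v) → (∀ u → c u ≡ c′ u) → cost s c ≡ cost s′ c′
cost-cong {n} {s} {s′} {c} {c′} s≗ c≗ =
  cong length (filter-≐ (λ e → disagrees s c e ≟ᵇ true) (λ e → disagrees s′ c′ e ≟ᵇ true)
                        ((λ {e} → trans (sym (same e))) , λ {e} → trans (same e)) (pairs n))
  where
  same : ∀ e → disagrees s c e ≡ disagrees s′ c′ e
  same (u , v) = trans (disagrees-congˡ {s = s} {s′} c (s≗ u v)) (disagrees-congʳ s′ (c≗ u) (c≗ v))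

tabulate∈allVecs : ∀ {k m} (c : Fin k → Fin m) → tabulate c ∈ allVecs k m
tabulate∈allVecs {zero}  c = here refl
tabulate∈allVecs {suc k} c =
  ∈-concatMap⁺ _ (lose (∈-allFin (c Fin.zero)) (∈-map⁺ (c Fin.zero Vec.∷_) (tabulate∈allVecs (c ∘ Fin.suc))))

OPT-≤-cost : ∀ {n} (s : Signs n) (c : Fin n → Fin n) → OPT s ℕ.≤ cost s c
OPT-≤-cost {zero}  s c = z≤n
OPT-≤-cost {suc n} s c = ℕ.≤-trans (minimumBy-≤ _ _ (tabulate∈allVecs c))
                                   (ℕ.≤-reflexive (cost-cong (λ _ _ → refl) (lookup∘tabulate c)))

OPT-attained : ∀ {n} (s : Signs n) → ∃ λ c → OPT s ≡ cost s c
OPT-attained {zero}  s = (λ ()) , refl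
OPT-attained {suc n} s with minimumBy-sel (cost s ∘ lookup) (cost s (λ _ → Fin.zero)) (allVecs (suc n) (suc n))
... | inj₁ ≡zero     = (λ _ → Fin.zero) , ≡zero
... | inj₂ (v , ≡v) = lookup v , ≡v

pairs-unique : ∀ n → Unique (pairs n)
pairs-unique n = dependentProduct⁺ _ (Unique.allFin⁺ n) (λ _ → Unique.filter⁺ _ (Unique.allFin⁺ n))

setSign-≢ : ∀ {n} {u v : Fin n} σ (s : Signs n) {x y} → (x , y) ≢ (u , v) → setSign u v σ s x y ≡ s x y
setSign-≢ {u = u} {v} σ s {x} {y} xy≢uv with x ≟ᶠ u | y ≟ᶠ v
... | yes refl | yes refl = contradiction refl xy≢uv
... | yes _    | no _     = refl
... | no _     | _        = refl

setSign-self : ∀ {n} {u v : Fin n} {σ} (s : Signs n) → s u v ≡ σ → ∀ x y → setSign u v σ s x y ≡ s x y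
setSign-self {u = u} {v} s s≡σ x y with x ≟ᶠ u | y ≟ᶠ v
... | yes refl | yes refl = sym s≡σ
... | yes _    | no _     = refl
... | no _     | _        = refl

cost-setSign-self : ∀ {n} {u v : Fin n} {σ} (s : Signs n) (c : Fin n → Fin n) →
                    s u v ≡ σ → cost (setSign u v σ s) c ≡ cost s c
cost-setSign-self s c s≡σ = cost-cong (setSign-self s s≡σ) (λ _ → refl)

cost-setSign-≤ : ∀ {n} (u v : Fin n) σ (s : Signs n) (c : Fin n → Fin n) →
                 cost (setSign u v σ s) c ℕ.≤ suc (cost s c)
cost-setSign-≤ {n} u v σ s c =
  length-filter-≤-suc _ _ (≡-dec _≟ᶠ_ _≟ᶠ_) (pairs-unique n)
    λ { {x , y} xy≢uv → trans (sym (disagrees-congˡ {s = setSign u v σ s} {s} c (setSign-≢ σ s xy≢uv))) }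

fromℕ≡mkℚ : ∀ m → fromℕ m ≡ mkℚ (+ m) 0 (coprime-sym (1-coprimeTo m))
fromℕ≡mkℚ m = normalize-coprime _

fromℕ-suc : ∀ m → fromℕ m + 1ℚ ≡ fromℕ (suc m)
fromℕ-suc m = trans (cong (_+ 1ℚ) (fromℕ≡mkℚ m))
  (cong (_/ 1) (trans (cong (ℤ._+ + 1) (ℤ.*-identityʳ (+ m))) (cong +_ (ℕ.+-comm m 1))))

fromℕ-mono-≤ : ∀ {m n} → m ℕ.≤ n → fromℕ m ≤ fromℕ n
fromℕ-mono-≤ {m} {n} m≤n rewrite fromℕ≡mkℚ m | fromℕ≡mkℚ n = *≤* (ℤ.*-monoʳ-≤-nonNeg (+ 1) (ℤ.+≤+ m≤n))

p≤p+q : ∀ p {q} → 0ℚ ≤ q → p ≤ p + q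
p≤p+q p 0≤q = ≤-trans (≤-reflexive (sym (+-identityʳ p))) (+-monoʳ-≤ p 0≤q)

p≤q⇒0≤q-p : ∀ {p q} → p ≤ q → 0ℚ ≤ q - p
p≤q⇒0≤q-p {p} p≤q = ≤-trans (≤-reflexive (sym (+-inverseʳ p))) (+-monoˡ-≤ _ p≤q)

*-nonNeg : ∀ {p q} → 0ℚ ≤ p → 0ℚ ≤ q → 0ℚ ≤ p * q
*-nonNeg {p} {q} 0≤p 0≤q = nonNegative⁻¹ _ {{nonNeg*nonNeg⇒nonNeg p {{nonNegative 0≤p}} q {{nonNegative 0≤q}}}}

*-monoˡ-≤ : ∀ {r p q} → 0ℚ ≤ r → p ≤ q → r * p ≤ r * q
*-monoˡ-≤ {r} 0≤r = *-monoˡ-≤-nonNeg r {{nonNegative 0≤r}}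

*-monoʳ-≤ : ∀ {r p q} → 0ℚ ≤ r → p ≤ q → p * r ≤ q * r
*-monoʳ-≤ {r} 0≤r = *-monoʳ-≤-nonNeg r {{nonNegative 0≤r}}

average-mono-≤ : ∀ {t x y x′ y′} → 0ℚ ≤ t → t ≤ 1ℚ → x ≤ x′ → y ≤ y′ →
                 (1ℚ - t) * x + t * y ≤ (1ℚ - t) * x′ + t * y′
average-mono-≤ 0≤t t≤1 x≤ y≤ = +-mono-≤ (*-monoˡ-≤ (p≤q⇒0≤q-p t≤1) x≤) (*-monoˡ-≤ 0≤t y≤)

module _ {A : Set} where

  sumℚ : (A → ℚ) → List A → ℚ
  sumℚ f = foldr (λ x r → f x + r) 0ℚ

  sumℚ-cong : ∀ {f g : A → ℚ} {xs} → All (λ x → f x ≡ g x) xs → sumℚ f xs ≡ sumℚ g xs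
  sumℚ-cong []           = refl
  sumℚ-cong (fx≡ ∷ fxs≡) = cong₂ _+_ fx≡ (sumℚ-cong fxs≡)

  sumℚ-mono-≤ : ∀ {f g : A → ℚ} → (∀ x → f x ≤ g x) → ∀ xs → sumℚ f xs ≤ sumℚ g xs
  sumℚ-mono-≤ f≤g []       = ≤-refl
  sumℚ-mono-≤ f≤g (x ∷ xs) = +-mono-≤ (f≤g x) (sumℚ-mono-≤ f≤g xs)

  sumℚ-*ˡ : ∀ r (f : A → ℚ) xs → sumℚ (λ x → r * f x) xs ≡ r * sumℚ f xs
  sumℚ-*ˡ r f []       = sym (*-zeroʳ r)
  sumℚ-*ˡ r f (x ∷ xs) = trans (cong (_+_ (r * f x)) (sumℚ-*ˡ r f xs)) (sym (*-distribˡ-+ r (f x) (sumℚ f xs)))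

-- For a pair of sign σ that becomes negative with probability x this is the probability that its
-- sign flips; for a distance x it is the pair's term in the predictor's cost.
mismatch : Bool → ℚ → ℚ
mismatch σ x = if σ then x else 1ℚ - x

expectedFlips : ∀ {n} → (Fin n → Fin n → ℚ) → Signs n → List (Fin n × Fin n) → ℚ
expectedFlips q s = sumℚ (λ (u , v) → mismatch (s u v) (q u v))

expectedFlips-setSign : ∀ {n} (q : Fin n → Fin n → ℚ) {u v : Fin n} σ (s : Signs n) {ps} →
                        All ((u , v) ≢_) ps → expectedFlips q (setSign u v σ s) ps ≡ expectedFlips q s ps
expectedFlips-setSign q σ s uv∉ =
  sumℚ-cong (All.map (λ { {x , y} uv≢xy → cong (λ τ → mismatch τ (q x y)) (setSign-≢ σ s (uv≢xy ∘ sym)) }) uv∉)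

average-kept-changed : ∀ t C F → (1ℚ - t) * (C + F) + t * ((C + 1ℚ) + F) ≡ C + (t + F)
average-kept-changed = solve 3 (λ t C F →
  (con 1ℚ :- t) :* (C :+ F) :+ t :* ((C :+ con 1ℚ) :+ F) := C :+ (t :+ F)) refl
  where open +-*-Solver

average-changed-kept : ∀ t C F → (1ℚ - t) * ((C + 1ℚ) + F) + t * (C + F) ≡ C + ((1ℚ - t) + F)
average-changed-kept = solve 3 (λ t C F →
  (con 1ℚ :- t) :* ((C :+ con 1ℚ) :+ F) :+ t :* (C :+ F) := C :+ ((con 1ℚ :- t) :+ F)) refl
  where open +-*-Solver

expectOPT-≤ : ∀ {n} (q : Fin n → Fin n → ℚ) → (∀ u v → 0ℚ ≤ q u v) → (∀ u v → q u v ≤ 1ℚ) →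
              (c : Fin n → Fin n) → ∀ {ps} → Unique ps → ∀ s →
              expectOPT q ps s ≤ fromℕ (cost s c) + expectedFlips q s ps
expectOPT-≤ q 0≤q q≤1 c [] s = ≤-trans (fromℕ-mono-≤ (OPT-≤-cost s c)) (p≤p+q _ ≤-refl)
expectOPT-≤ q 0≤q q≤1 c {(u , v) ∷ ps} (uv∉ ∷ !ps) s = by-sign (s u v) refl
  where
  C F : ℚ
  C = fromℕ (cost s c)
  F = expectedFlips q s ps

  IH : ∀ σ → expectOPT q ps (setSign u v σ s) ≤ fromℕ (cost (setSign u v σ s) c) + F
  IH σ = subst (λ F′ → expectOPT q ps (setSign u v σ s) ≤ fromℕ (cost (setSign u v σ s) c) + F′)
               (expectedFlips-setSign q σ s uv∉) (expectOPT-≤ q 0≤q q≤1 c !ps (setSign u v σ s))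

  kept : ∀ {σ} → s u v ≡ σ → expectOPT q ps (setSign u v σ s) ≤ C + F
  kept s≡σ = ≤-trans (IH _) (≤-reflexive (cong (λ k → fromℕ k + F) (cost-setSign-self s c s≡σ)))

  changed : ∀ σ → expectOPT q ps (setSign u v σ s) ≤ (C + 1ℚ) + F
  changed σ = ≤-trans (IH σ) (+-monoˡ-≤ F (≤-trans (fromℕ-mono-≤ (cost-setSign-≤ u v σ s c))
                                                    (≤-reflexive (sym (fromℕ-suc (cost s c))))))

  by-sign : ∀ σ → s u v ≡ σ → expectOPT q ((u , v) ∷ ps) s ≤ C + (mismatch σ (q u v) + F)
  by-sign true  s≡ = ≤-trans (average-mono-≤ (0≤q u v) (q≤1 u v) (kept s≡) (changed false))
                             (≤-reflexive (average-kept-changed (q u v) C F))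
  by-sign false s≡ = ≤-trans (average-mono-≤ (0≤q u v) (q≤1 u v) (changed true) (kept s≡))
                             (≤-reflexive (average-changed-kept (q u v) C F))

ramp : ℚ → ℚ
ramp x = (x - a) * inv[b-a]

f⁺-elim : (P : ℚ → Set) → ∀ x → (x < a → P 0ℚ) → (a ≤ x → x ≤ b → P (ramp x * ramp x)) → (b < x → P 1ℚ) →
          P (f⁺ x)
f⁺-elim P x below inside above = piecewise (x <? a) (x ≤? b)
  where
  piecewise : (x<a? : Dec (x < a)) (x≤b? : Dec (x ≤ b)) →
              P (if ⌊ x<a? ⌋ then 0ℚ else if ⌊ x≤b? ⌋ then ramp x * ramp x else 1ℚ)
  piecewise (yes x<a) _         = below x<a
  piecewise (no x≮a)  (yes x≤b) = inside (≮⇒≥ x≮a) x≤b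
  piecewise (no _)    (no x≰b)  = above (≰⇒> x≰b)

0≤inv[b-a] : 0ℚ ≤ inv[b-a]
0≤inv[b-a] = toWitness {a? = 0ℚ ≤? inv[b-a]} tt

2≤inv[b-a] : fromℕ 2 ≤ inv[b-a]
2≤inv[b-a] = toWitness {a? = fromℕ 2 ≤? inv[b-a]} tt

1≤2b : 1ℚ ≤ fromℕ 2 * b
1≤2b = toWitness {a? = 1ℚ ≤? fromℕ 2 * b} tt

0≤1 : 0ℚ ≤ 1ℚ
0≤1 = toWitness {a? = 0ℚ ≤? 1ℚ} tt

0≤2 : 0ℚ ≤ fromℕ 2
0≤2 = toWitness {a? = 0ℚ ≤? fromℕ 2} tt

ramp-nonNeg : ∀ {x} → a ≤ x → 0ℚ ≤ ramp x
ramp-nonNeg a≤x = *-nonNeg (p≤q⇒0≤q-p a≤x) 0≤inv[b-a]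

ramp-≤-1 : ∀ {x} → x ≤ b → ramp x ≤ 1ℚ
ramp-≤-1 x≤b = *-monoʳ-≤ 0≤inv[b-a] (+-monoˡ-≤ _ x≤b)

ramp-≤-2x : ∀ {x} → x ≤ b → ramp x ≤ fromℕ 2 * x
ramp-≤-2x {x} x≤b =
  ≤-trans (p≤p+q (ramp x) (+-mono-≤ (*-nonNeg (p≤q⇒0≤q-p x≤b) (p≤q⇒0≤q-p 2≤inv[b-a])) (p≤q⇒0≤q-p 1≤2b)))
          (≤-reflexive (ramp-slack a b inv[b-a] (fromℕ 2) x))
  where
  open +-*-Solver
  -- 2x − ramp x splits into two nonnegative terms, using (b − a) · inv[b-a] = 1.
  ramp-slack : ∀ a b k w x → (x - a) * k + ((b - x) * (k - w) + (w * b - (b - a) * k)) ≡ w * x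
  ramp-slack = solve 5 (λ a b k w x →
    (x :- a) :* k :+ ((b :- x) :* (k :- w) :+ (w :* b :- (b :- a) :* k)) := w :* x) refl

square-≤ : ∀ {t} → 0ℚ ≤ t → t ≤ 1ℚ → t * t ≤ t
square-≤ {t} 0≤t t≤1 = ≤-trans (*-monoʳ-≤ 0≤t t≤1) (≤-reflexive (*-identityˡ t))

f⁺-nonNeg : ∀ x → 0ℚ ≤ f⁺ x
f⁺-nonNeg x = f⁺-elim (0ℚ ≤_) x (λ _ → ≤-refl) (λ a≤x _ → *-nonNeg (ramp-nonNeg a≤x) (ramp-nonNeg a≤x)) (λ _ → 0≤1)

f⁺-≤-1 : ∀ x → f⁺ x ≤ 1ℚ
f⁺-≤-1 x = f⁺-elim (_≤ 1ℚ) x (λ _ → 0≤1)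
  (λ a≤x x≤b → ≤-trans (square-≤ (ramp-nonNeg a≤x) (ramp-≤-1 x≤b)) (ramp-≤-1 x≤b)) (λ _ → ≤-refl)

f⁺-≤-2x : ∀ {x} → 0ℚ ≤ x → f⁺ x ≤ fromℕ 2 * x
f⁺-≤-2x {x} 0≤x = f⁺-elim (_≤ fromℕ 2 * x) x (λ _ → *-nonNeg 0≤2 0≤x)
  (λ a≤x x≤b → ≤-trans (square-≤ (ramp-nonNeg a≤x) (ramp-≤-1 x≤b)) (ramp-≤-2x x≤b))
  (λ b<x → ≤-trans 1≤2b (*-monoˡ-≤ 0≤2 (<⇒≤ b<x)))

rounding-nonNeg : ∀ σ {x} → 0ℚ ≤ x → 0ℚ ≤ (if σ then f⁺ x else f⁻ x)
rounding-nonNeg true  {x} _ = f⁺-nonNeg x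
rounding-nonNeg false     0≤x = 0≤x

rounding-≤-1 : ∀ σ {x} → x ≤ 1ℚ → (if σ then f⁺ x else f⁻ x) ≤ 1ℚ
rounding-≤-1 true  {x} _ = f⁺-≤-1 x
rounding-≤-1 false     x≤1 = x≤1

mismatch-rounding-≤ : ∀ σ {x} → 0ℚ ≤ x → x ≤ 1ℚ → mismatch σ (if σ then f⁺ x else f⁻ x) ≤ fromℕ 2 * mismatch σ x
mismatch-rounding-≤ true  0≤x _   = f⁺-≤-2x 0≤x
mismatch-rounding-≤ false {x} _ x≤1 = ≤-trans (p≤p+q _ (p≤q⇒0≤q-p x≤1)) (≤-reflexive (double (1ℚ - x)))
  where
  open +-*-Solver
  double : ∀ y → y + y ≡ fromℕ 2 * y
  double = solve 1 (λ y → y :+ y := (con 1ℚ :+ con 1ℚ) :* y) refl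

expectedFlips-rounding-≤ : ∀ {n} (s : Signs n) (d : Fin n → Fin n → ℚ) →
                           (∀ u v → 0ℚ ≤ d u v) → (∀ u v → d u v ≤ 1ℚ) →
                           expectedFlips (prob s d) s (pairs n) ≤ fromℕ 2 * predictorCost s d
expectedFlips-rounding-≤ {n} s d 0≤d d≤1 =
  ≤-trans (sumℚ-mono-≤ (λ (u , v) → mismatch-rounding-≤ (s u v) (0≤d u v) (d≤1 u v)) (pairs n))
          (≤-reflexive (sumℚ-*ˡ (fromℕ 2) (λ (u , v) → mismatch (s u v) (d u v)) (pairs n)))

lemma23 : (n : ℕ) (s : Signs n) (β : ℚ) (d : Fin n → Fin n → ℚ) →
    IsPredictor s β d →
    EOPT' s d ≤ (fromℕ 2 * β + 1ℚ) * fromℕ (OPT s)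
lemma23 n s β d P = begin
  EOPT' s d                         ≤⟨ expectOPT-≤ (prob s d) 0≤p p≤1 c (pairs-unique n) s ⟩
  fromℕ (cost s c) + F              ≡⟨ cong (λ k → fromℕ k + F) (sym OPT≡cost) ⟩
  O + F                             ≤⟨ +-monoʳ-≤ O (expectedFlips-rounding-≤ s d nonneg le-one) ⟩
  O + fromℕ 2 * predictorCost s d   ≤⟨ +-monoʳ-≤ O (*-monoˡ-≤ 0≤2 bounded) ⟩
  O + fromℕ 2 * (β * O)             ≡⟨ regroup (fromℕ 2) β O ⟩
  (fromℕ 2 * β + 1ℚ) * O            ∎
  where
  open IsPredictor P
  open ≤-Reasoning
  open +-*-Solver
  O F : ℚ
  O = fromℕ (OPT s)
  F = expectedFlips (prob s d) s (pairs n)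
  c : Fin n → Fin n
  c = proj₁ (OPT-attained s)
  OPT≡cost : OPT s ≡ cost s c
  OPT≡cost = proj₂ (OPT-attained s)
  0≤p : ∀ u v → 0ℚ ≤ prob s d u v
  0≤p u v = rounding-nonNeg (s u v) (nonneg u v)
  p≤1 : ∀ u v → prob s d u v ≤ 1ℚ
  p≤1 u v = rounding-≤-1 (s u v) (le-one u v)
  regroup : ∀ w β O → O + w * (β * O) ≡ (w * β + 1ℚ) * O
  regroup = solve 3 (λ w β O → O :+ w :* (β :* O) := (w :* β :+ con 1ℚ) :* O) refl
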